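{- Let $n$ be a positive integer such that a Hadamard matrix of order $n$ exists. Then: (i) there exists a symmetric $(1,-1)$-matrix $M$ of order $n(n-1)$ whose rows can be partitioned into $n-1$ classes of $n$ rows each such that, for the normalized rows (rows divided by their Euclidean norm $\sqrt{n(n-1)}$), $|\langle u,v\rangle|=\frac{1}{n-1}$ for any two distinct rows $u,v$ in the same class and $|\langle u,v\rangle|=0$ for any two rows in different classes (i.e. a symmetric regular biangular matrix with angles $\{0,\frac1{n-1}\}$); (ii) there exists a $(1,-1)$-matrix $M$ of order $n(n-1)$ with the same property, where the classes are the $n-1$ consecutive blocks of $n$ rows, and which is skew-symmetric in the sense that, writing $M=(M_{ij})_{i,j=1}^{n-1}$ with $n\times n$ blocks according to these classes, $M_{ij}^T=-M_{ji}$ for all distinct $i,j$.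
   Context: A Hadamard matrix of order $n$ is an $n\times n$ $(1,-1)$-matrix $H$ with $HH^T=nI_n$. An $(\alpha,\beta)$-biangular matrix is a $(1,-1)$-matrix whose normalized rows have pairwise inner products (in absolute value) in $\{\alpha,\beta\}$; it is regular if its rows can be partitioned into classes of equal size so that one of the two values occurs for pairs within a class and the other for pairs in different classes. -}

module Defs where

open import Data.Nat using (ℕ; zero; suc; _*_; _∸_)
open import Data.Integer as ℤ using (ℤ; +_; -_; ∣_∣)
open import Data.Fin using (Fin; zero; suc; combine)
open import Data.Product using (_×_; _,_; Σ; ∃)
open import Data.Sum using (_⊎_)
open import Relation.Binary.PropositionalEquality using (_≡_)
open import Relation.Nullary using (¬_)
open import Function.Bundles using (_⤖_; Bijection)

Matrix : ℕ → Set
Matrix m = Fin m → Fin m → ℤ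

∑ : (m : ℕ) → (Fin m → ℤ) → ℤ
∑ zero    f = + 0
∑ (suc m) f = f zero ℤ.+ ∑ m (λ i → f (suc i))

IsPM1 : {m : ℕ} → Matrix m → Set
IsPM1 {m} M = ∀ (i j : Fin m) → (M i j ≡ + 1) ⊎ (M i j ≡ - (+ 1))

rowDot : {m : ℕ} → Matrix m → Fin m → Fin m → ℤ
rowDot {m} M i j = ∑ m (λ k → M i k ℤ.* M j k)

δ : {m : ℕ} → Fin m → Fin m → ℤ
δ zero    zero    = + 1
δ zero    (suc j) = + 0
δ (suc i) zero    = + 0
δ (suc i) (suc j) = δ i j

IsHadamard : (n : ℕ) → Matrix n → Set
IsHadamard n H = IsPM1 H × (∀ i j → rowDot H i j ≡ + n ℤ.* δ i j)

Symmetric : {m : ℕ} → Matrix m → Set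
Symmetric {m} M = ∀ (i j : Fin m) → M i j ≡ M j i

-- Normalised rows have norm² = 1, and the normalised inner product is
-- rowDot / (n(n-1)); so |.| = 1/(n-1) iff |rowDot| = n, and = 0 iff rowDot = 0.
BiangularClasses : (n N : ℕ) → Matrix N → (Fin (n ∸ 1) × Fin n → Fin N) → Set
BiangularClasses n N M cls =
  (∀ (k : Fin (n ∸ 1)) (a b : Fin n) → ¬ a ≡ b →
     ∣ rowDot M (cls (k , a)) (cls (k , b)) ∣ ≡ n)
  × (∀ (k l : Fin (n ∸ 1)) (a b : Fin n) → ¬ k ≡ l →
     rowDot M (cls (k , a)) (cls (l , b)) ≡ + 0)

-- consecutive blocks: row (k , a) is row number k*n + a
blockIndex : (n : ℕ) → Fin (n ∸ 1) × Fin n → Fin ((n ∸ 1) * n)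
blockIndex n (k , a) = combine k a

BlockSkew : (n : ℕ) → Matrix ((n ∸ 1) * n) → Set
BlockSkew n M = ∀ (k l : Fin (n ∸ 1)) (a b : Fin n) → ¬ k ≡ l →
  M (combine k b) (combine l a) ≡ - M (combine l a) (combine k b)

-- Let H be Hadamard of order n = m + 1 and σ a (±1)-valued function on pairs of indices in
-- Fin m. The matrix with rows and columns indexed by Fin m × Fin n and entries
--   M (k , a) (l , b) = σ k l · H a (l + 1) · H b (k + 1)
-- has row inner products (∑ₗ σ k l σ k′ l H a (l+1) H a′ (l+1)) · ⟨column k+1, column k′+1⟩ of H.
-- The columns of H are orthogonal too (HᵀH = nI), so rows in different classes are orthogonal,
-- and within a class the product is n times the inner product of rows a, a′ of H with column 0
-- deleted, i.e. −n H a 0 H a′ 0. Taking σ ≡ 1 gives a symmetric matrix, and taking σ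
-- antisymmetric off the diagonal gives the block skew one.
module Submission where

open import Defs
open import Data.Nat as ℕ using (ℕ; zero; suc; NonZero)
import Data.Nat.Properties as ℕP
open import Data.Integer using (ℤ; +_; -_; _+_; _-_; _*_; ∣_∣; 0ℤ; 1ℤ; -1ℤ; _≤_; +≤+; -[1+_])
import Data.Integer.Properties as ℤP
open import Data.Integer.Tactic.RingSolver using (solve-∀)
open import Data.Fin using (Fin; zero; suc; combine; remQuot; _↑ˡ_; _↑ʳ_)
import Data.Fin.Properties as FinP
open import Data.Product using (_×_; _,_; proj₁; proj₂; Σ; ∃)
open import Data.Sum using (_⊎_; inj₁; inj₂; reduce)
open import Function using (_∘_)
open import Function.Bundles using (_⤖_; Bijection)
open import Function.Properties.Inverse using (↔-sym; ↔⇒⤖)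
open import Relation.Binary.PropositionalEquality
open import Relation.Nullary using (¬_; yes; no; contradiction)
open import Algebra.Properties.AbelianGroup ℤP.+-0-abelianGroup using ()
  renaming (inverseʳ-unique to +-inverseʳ-unique)

∑-cong : ∀ m {f g : Fin m → ℤ} → (∀ i → f i ≡ g i) → ∑ m f ≡ ∑ m g
∑-cong zero    f≗g = refl
∑-cong (suc m) f≗g = cong₂ _+_ (f≗g zero) (∑-cong m (f≗g ∘ suc))

∑-const : ∀ m c → ∑ m (λ _ → c) ≡ + m * c
∑-const zero    c = refl
∑-const (suc m) c = trans (cong (_+_ c) (∑-const m c)) (sym (ℤP.suc-* (+ m) c))

∑-zero : ∀ m → ∑ m (λ _ → 0ℤ) ≡ 0ℤ
∑-zero m = trans (∑-const m 0ℤ) (ℤP.*-zeroʳ (+ m))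

∑-distrib-+ : ∀ m (f g : Fin m → ℤ) → ∑ m (λ i → f i + g i) ≡ ∑ m f + ∑ m g
∑-distrib-+ zero    f g = refl
∑-distrib-+ (suc m) f g =
  trans (cong (_+_ (f zero + g zero)) (∑-distrib-+ m (f ∘ suc) (g ∘ suc)))
        (interchange (f zero) (g zero) _ _)
  where
  interchange : ∀ a b c d → a + b + (c + d) ≡ a + c + (b + d)
  interchange = solve-∀

*-distribˡ-∑ : ∀ m c (f : Fin m → ℤ) → c * ∑ m f ≡ ∑ m (λ i → c * f i)
*-distribˡ-∑ zero    c f = ℤP.*-zeroʳ c
*-distribˡ-∑ (suc m) c f =
  trans (ℤP.*-distribˡ-+ c (f zero) _) (cong (_+_ (c * f zero)) (*-distribˡ-∑ m c (f ∘ suc)))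

*-distribʳ-∑ : ∀ m c (f : Fin m → ℤ) → ∑ m f * c ≡ ∑ m (λ i → f i * c)
*-distribʳ-∑ m c f =
  trans (ℤP.*-comm (∑ m f) c) (trans (*-distribˡ-∑ m c f) (∑-cong m (λ i → ℤP.*-comm c (f i))))

∑-comm : ∀ m k (f : Fin m → Fin k → ℤ) →
         ∑ m (λ i → ∑ k (f i)) ≡ ∑ k (λ j → ∑ m (λ i → f i j))
∑-comm zero    k f = sym (∑-zero k)
∑-comm (suc m) k f =
  trans (cong (_+_ (∑ k (f zero))) (∑-comm m k (f ∘ suc)))
        (sym (∑-distrib-+ k (f zero) (λ j → ∑ m (λ i → f (suc i) j))))

∑²-comm : ∀ m k (f : Fin m → Fin m → Fin k → Fin k → ℤ) →
          ∑ m (λ i → ∑ m (λ i′ → ∑ k (λ j → ∑ k (f i i′ j)))) ≡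
          ∑ k (λ j → ∑ k (λ j′ → ∑ m (λ i → ∑ m (λ i′ → f i i′ j j′))))
∑²-comm m k f = begin
  ∑ m (λ i → ∑ m (λ i′ → ∑ k (λ j → ∑ k (f i i′ j))))
    ≡⟨ ∑-cong m (λ i → ∑-comm m k _) ⟩
  ∑ m (λ i → ∑ k (λ j → ∑ m (λ i′ → ∑ k (f i i′ j))))
    ≡⟨ ∑-comm m k _ ⟩
  ∑ k (λ j → ∑ m (λ i → ∑ m (λ i′ → ∑ k (f i i′ j))))
    ≡⟨ ∑-cong k (λ j → ∑-cong m (λ i → ∑-comm m k _)) ⟩
  ∑ k (λ j → ∑ m (λ i → ∑ k (λ j′ → ∑ m (λ i′ → f i i′ j j′))))
    ≡⟨ ∑-cong k (λ j → ∑-comm m k _) ⟩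
  ∑ k (λ j → ∑ k (λ j′ → ∑ m (λ i → ∑ m (λ i′ → f i i′ j j′))))
    ∎
  where open ≡-Reasoning

∑-*-∑ : ∀ m k (f : Fin m → ℤ) (g : Fin k → ℤ) →
        ∑ m f * ∑ k g ≡ ∑ m (λ i → ∑ k (λ j → f i * g j))
∑-*-∑ m k f g =
  trans (*-distribʳ-∑ m (∑ k g) f) (∑-cong m (λ i → *-distribˡ-∑ k (f i) g))

∑-linear : ∀ m a b (f g h : Fin m → ℤ) →
           ∑ m (λ i → f i + a * g i + b * h i) ≡ ∑ m f + a * ∑ m g + b * ∑ m h
∑-linear m a b f g h =
  trans (∑-distrib-+ m _ _)
    (cong₂ _+_ (trans (∑-distrib-+ m _ _) (cong (_+_ (∑ m f)) (sym (*-distribˡ-∑ m a g))))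
               (sym (*-distribˡ-∑ m b h)))

∑-↑ : ∀ a b (f : Fin (a ℕ.+ b) → ℤ) →
      ∑ (a ℕ.+ b) f ≡ ∑ a (λ i → f (i ↑ˡ b)) + ∑ b (λ j → f (a ↑ʳ j))
∑-↑ zero    b f = sym (ℤP.+-identityˡ _)
∑-↑ (suc a) b f =
  trans (cong (_+_ (f zero)) (∑-↑ a b (f ∘ suc))) (sym (ℤP.+-assoc (f zero) _ _))

∑-combine : ∀ m k (f : Fin (m ℕ.* k) → ℤ) →
            ∑ (m ℕ.* k) f ≡ ∑ m (λ i → ∑ k (λ j → f (combine i j)))
∑-combine zero    k f = refl
∑-combine (suc m) k f =
  trans (∑-↑ k (m ℕ.* k) f)
        (cong (_+_ (∑ k (λ j → f (j ↑ˡ m ℕ.* k)))) (∑-combine m k (λ x → f (k ↑ʳ x))))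

δ-refl : ∀ {m} (i : Fin m) → δ i i ≡ 1ℤ
δ-refl zero    = refl
δ-refl (suc i) = δ-refl i

δ-≢ : ∀ {m} {i j : Fin m} → ¬ i ≡ j → δ i j ≡ 0ℤ
δ-≢ {i = zero}  {zero}  i≢j = contradiction refl i≢j
δ-≢ {i = zero}  {suc j} i≢j = refl
δ-≢ {i = suc i} {zero}  i≢j = refl
δ-≢ {i = suc i} {suc j} i≢j = δ-≢ (i≢j ∘ cong suc)

∑-δ : ∀ m (i : Fin m) (f : Fin m → ℤ) → ∑ m (λ j → δ i j * f j) ≡ f i
∑-δ (suc m) zero    f =
  trans (cong₂ _+_ (ℤP.*-identityˡ (f zero)) (∑-zero m)) (ℤP.+-identityʳ (f zero))
∑-δ (suc m) (suc i) f = trans (ℤP.+-identityˡ _) (∑-δ m i (f ∘ suc))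

0≤i*i : ∀ i → 0ℤ ≤ i * i
0≤i*i (+ n)    = subst (0ℤ ≤_) (ℤP.pos-* n n) (+≤+ ℕ.z≤n)
0≤i*i -[1+ n ] = +≤+ ℕ.z≤n

i*i≡0⇒i≡0 : ∀ i → i * i ≡ 0ℤ → i ≡ 0ℤ
i*i≡0⇒i≡0 i eq = reduce (ℤP.i*j≡0⇒i≡0∨j≡0 i eq)

nonNeg-+≡0⇒≡0 : ∀ {i j} → 0ℤ ≤ i → 0ℤ ≤ j → i + j ≡ 0ℤ → i ≡ 0ℤ × j ≡ 0ℤ
nonNeg-+≡0⇒≡0 {+ m} {+ n} (+≤+ _) (+≤+ _) eq =
  cong +_ (ℕP.m+n≡0⇒m≡0 m (ℤP.+-injective eq)) , cong +_ (ℕP.m+n≡0⇒n≡0 m (ℤP.+-injective eq))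

∑-nonNeg : ∀ m (f : Fin m → ℤ) → (∀ i → 0ℤ ≤ f i) → 0ℤ ≤ ∑ m f
∑-nonNeg zero    f f≥0 = +≤+ ℕ.z≤n
∑-nonNeg (suc m) f f≥0 = ℤP.+-mono-≤ (f≥0 zero) (∑-nonNeg m (f ∘ suc) (f≥0 ∘ suc))

∑-nonNeg≡0⇒≡0 : ∀ m (f : Fin m → ℤ) → (∀ i → 0ℤ ≤ f i) → ∑ m f ≡ 0ℤ → ∀ i → f i ≡ 0ℤ
∑-nonNeg≡0⇒≡0 (suc m) f f≥0 ∑≡0 i = split i
  where
  parts : f zero ≡ 0ℤ × ∑ m (f ∘ suc) ≡ 0ℤ
  parts = nonNeg-+≡0⇒≡0 (f≥0 zero) (∑-nonNeg m (f ∘ suc) (f≥0 ∘ suc)) ∑≡0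

  split : ∀ i → f i ≡ 0ℤ
  split zero    = proj₁ parts
  split (suc i) = ∑-nonNeg≡0⇒≡0 m (f ∘ suc) (f≥0 ∘ suc) (proj₂ parts) i

transpose : ∀ {m} → Matrix m → Matrix m
transpose M i j = M j i

trace : ∀ {m} → Matrix m → ℤ
trace {m} X = ∑ m (λ i → X i i)

‖_‖² : ∀ {m} → Matrix m → ℤ
‖_‖² {m} X = ∑ m (λ i → ∑ m (λ j → X i j * X i j))

‖‖²≡0⇒≡0 : ∀ {m} (X : Matrix m) → ‖ X ‖² ≡ 0ℤ → ∀ i j → X i j ≡ 0ℤ
‖‖²≡0⇒≡0 {m} X ‖X‖²≡0 i j =
  i*i≡0⇒i≡0 (X i j) (∑-nonNeg≡0⇒≡0 m (λ j → X i j * X i j) (λ j → 0≤i*i (X i j)) rowᵢ≡0 j)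
  where
  rowᵢ≡0 : ∑ m (λ j → X i j * X i j) ≡ 0ℤ
  rowᵢ≡0 = ∑-nonNeg≡0⇒≡0 m (λ i → ∑ m (λ j → X i j * X i j))
                            (λ i → ∑-nonNeg m _ (λ j → 0≤i*i (X i j))) ‖X‖²≡0 i

‖-‖²-sub-scaled-δ : ∀ {m} (X : Matrix m) c →
  ‖ (λ i j → X i j - c * δ i j) ‖² ≡ ‖ X ‖² - + 2 * c * trace X + c * c * + m
‖-‖²-sub-scaled-δ {m} X c = begin
  ‖ (λ i j → X i j - c * δ i j) ‖²
    ≡⟨ ∑-cong m (λ i → ∑-cong m (λ j → expand (X i j) (δ i j) c)) ⟩
  ∑ m (λ i → ∑ m (λ j → X i j * X i j + - (+ 2 * c) * (δ i j * X i j) + c * c * (δ i j * δ i j)))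
    ≡⟨ ∑-cong m (λ i → ∑-linear m (- (+ 2 * c)) (c * c)
                         (λ j → X i j * X i j) (λ j → δ i j * X i j) (λ j → δ i j * δ i j)) ⟩
  ∑ m (λ i → ∑ m (λ j → X i j * X i j) + - (+ 2 * c) * ∑ m (λ j → δ i j * X i j)
                                      + c * c * ∑ m (λ j → δ i j * δ i j))
    ≡⟨ ∑-cong m (λ i → cong₂ (λ u v → ∑ m (λ j → X i j * X i j) + - (+ 2 * c) * u + c * c * v)
                             (∑-δ m i (X i)) (trans (∑-δ m i (δ i)) (δ-refl i))) ⟩
  ∑ m (λ i → ∑ m (λ j → X i j * X i j) + - (+ 2 * c) * X i i + c * c * 1ℤ)
    ≡⟨ ∑-linear m (- (+ 2 * c)) (c * c) (λ i → ∑ m (λ j → X i j * X i j)) (λ i → X i i) (λ _ → 1ℤ) ⟩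
  ‖ X ‖² + - (+ 2 * c) * trace X + c * c * ∑ m (λ _ → 1ℤ)
    ≡⟨ cong₂ _+_ (cong (_+_ ‖ X ‖²) (sym (ℤP.neg-distribˡ-* (+ 2 * c) (trace X))))
                 (cong (c * c *_) (trans (∑-const m 1ℤ) (ℤP.*-identityʳ (+ m)))) ⟩
  ‖ X ‖² - + 2 * c * trace X + c * c * + m
    ∎
  where
  open ≡-Reasoning
  expand : ∀ x d c → (x - c * d) * (x - c * d) ≡ x * x + - (+ 2 * c) * (d * x) + c * c * (d * d)
  expand = solve-∀

trace-gram-transpose : ∀ {m} (M : Matrix m) → trace (rowDot (transpose M)) ≡ trace (rowDot M)
trace-gram-transpose {m} M = ∑-comm m m (λ j i → M i j * M i j)

‖gram-transpose‖² : ∀ {m} (M : Matrix m) → ‖ rowDot (transpose M) ‖² ≡ ‖ rowDot M ‖²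
‖gram-transpose‖² {m} M = begin
  ∑ m (λ j → ∑ m (λ j′ → rowDot (transpose M) j j′ * rowDot (transpose M) j j′))
    ≡⟨ ∑-cong m (λ j → ∑-cong m (λ j′ →
         ∑-*-∑ m m (λ i → M i j * M i j′) (λ i′ → M i′ j * M i′ j′))) ⟩
  ∑ m (λ j → ∑ m (λ j′ → ∑ m (λ i → ∑ m (λ i′ → (M i j * M i j′) * (M i′ j * M i′ j′)))))
    ≡⟨ ∑²-comm m m _ ⟩
  ∑ m (λ i → ∑ m (λ i′ → ∑ m (λ j → ∑ m (λ j′ → (M i j * M i j′) * (M i′ j * M i′ j′)))))
    ≡⟨ ∑-cong m (λ i → ∑-cong m (λ i′ → ∑-cong m (λ j → ∑-cong m (λ j′ →
         middle-swap (M i j) (M i j′) (M i′ j) (M i′ j′))))) ⟩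
  ∑ m (λ i → ∑ m (λ i′ → ∑ m (λ j → ∑ m (λ j′ → (M i j * M i′ j) * (M i j′ * M i′ j′)))))
    ≡⟨ ∑-cong m (λ i → ∑-cong m (λ i′ →
         sym (∑-*-∑ m m (λ j → M i j * M i′ j) (λ j′ → M i j′ * M i′ j′)))) ⟩
  ∑ m (λ i → ∑ m (λ i′ → rowDot M i i′ * rowDot M i i′))
    ∎
  where
  open ≡-Reasoning
  middle-swap : ∀ a b c d → (a * b) * (c * d) ≡ (a * c) * (b * d)
  middle-swap = solve-∀

-- The trace and Frobenius identities give ‖MᵀM − cI‖² = ‖MMᵀ − cI‖², which vanishes.
transpose-orthogonal : ∀ {m} (M : Matrix m) c →
  (∀ i j → rowDot M i j ≡ c * δ i j) → ∀ i j → rowDot (transpose M) i j ≡ c * δ i j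
transpose-orthogonal {m} M c orthogonal i j =
  ℤP.i-j≡0⇒i≡j _ _ (‖‖²≡0⇒≡0 (deviation (transpose M)) ‖deviation‖²≡0 i j)
  where
  open ≡-Reasoning
  deviation : Matrix m → Matrix m
  deviation A i j = rowDot A i j - c * δ i j

  ‖deviation‖²≡0 : ‖ deviation (transpose M) ‖² ≡ 0ℤ
  ‖deviation‖²≡0 = begin
    ‖ deviation (transpose M) ‖²
      ≡⟨ ‖-‖²-sub-scaled-δ (rowDot (transpose M)) c ⟩
    ‖ rowDot (transpose M) ‖² - + 2 * c * trace (rowDot (transpose M)) + c * c * + m
      ≡⟨ cong₂ (λ u v → u - + 2 * c * v + c * c * + m) (‖gram-transpose‖² M) (trace-gram-transpose M) ⟩
    ‖ rowDot M ‖² - + 2 * c * trace (rowDot M) + c * c * + m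
      ≡⟨ ‖-‖²-sub-scaled-δ (rowDot M) c ⟨
    ‖ deviation M ‖²
      ≡⟨ ∑-cong m (λ i → ∑-cong m (λ j → cong (λ x → x * x) (ℤP.i≡j⇒i-j≡0 (orthogonal i j)))) ⟩
    ∑ m (λ _ → ∑ m (λ _ → 0ℤ))
      ≡⟨ trans (∑-cong m (λ _ → ∑-zero m)) (∑-zero m) ⟩
    0ℤ
      ∎

IsSign : ℤ → Set
IsSign x = x ≡ 1ℤ ⊎ x ≡ -1ℤ

sign-* : ∀ {x y} → IsSign x → IsSign y → IsSign (x * y)
sign-* (inj₁ refl) (inj₁ refl) = inj₁ refl
sign-* (inj₁ refl) (inj₂ refl) = inj₂ refl
sign-* (inj₂ refl) (inj₁ refl) = inj₂ refl
sign-* (inj₂ refl) (inj₂ refl) = inj₁ refl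

sign*sign≡1 : ∀ {x} → IsSign x → x * x ≡ 1ℤ
sign*sign≡1 (inj₁ refl) = refl
sign*sign≡1 (inj₂ refl) = refl

∣sign∣≡1 : ∀ {x} → IsSign x → ∣ x ∣ ≡ 1
∣sign∣≡1 (inj₁ refl) = refl
∣sign∣≡1 (inj₂ refl) = refl

module BlockConstruction {m : ℕ} (σ : Fin m → Fin m → ℤ) (H : Matrix (suc m)) where

  entry : Fin m × Fin (suc m) → Fin m × Fin (suc m) → ℤ
  entry (k , a) (l , b) = σ k l * (H a (suc l) * H b (suc k))

  blockMatrix : Matrix (m ℕ.* suc m)
  blockMatrix x y = entry (remQuot (suc m) x) (remQuot (suc m) y)

  blockMatrix-combine : ∀ k a l b →
    blockMatrix (combine k a) (combine l b) ≡ σ k l * (H a (suc l) * H b (suc k))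
  blockMatrix-combine k a l b = cong₂ entry (FinP.remQuot-combine k a) (FinP.remQuot-combine l b)

  coefficient : Fin m → Fin (suc m) → Fin m → Fin (suc m) → Fin m → ℤ
  coefficient k a k′ a′ l = σ k l * σ k′ l * (H a (suc l) * H a′ (suc l))

  rowDot-blockMatrix : ∀ k a k′ a′ →
    rowDot blockMatrix (combine k a) (combine k′ a′) ≡
    ∑ m (coefficient k a k′ a′) * rowDot (transpose H) (suc k) (suc k′)
  rowDot-blockMatrix k a k′ a′ = begin
    rowDot blockMatrix (combine k a) (combine k′ a′)
      ≡⟨ ∑-combine m (suc m) (λ y → blockMatrix (combine k a) y * blockMatrix (combine k′ a′) y) ⟩
    ∑ m (λ l → ∑ (suc m) (λ b →
      blockMatrix (combine k a) (combine l b) * blockMatrix (combine k′ a′) (combine l b)))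
      ≡⟨ ∑-cong m (λ l → ∑-cong (suc m) (λ b →
           trans (cong₂ _*_ (blockMatrix-combine k a l b) (blockMatrix-combine k′ a′ l b))
                 (regroup (σ k l) (σ k′ l) (H a (suc l)) (H a′ (suc l)) (H b (suc k)) (H b (suc k′))))) ⟩
    ∑ m (λ l → ∑ (suc m) (λ b → c l * (H b (suc k) * H b (suc k′))))
      ≡⟨ ∑-cong m (λ l → *-distribˡ-∑ (suc m) (c l) (λ b → H b (suc k) * H b (suc k′))) ⟨
    ∑ m (λ l → c l * rowDot (transpose H) (suc k) (suc k′))
      ≡⟨ *-distribʳ-∑ m (rowDot (transpose H) (suc k) (suc k′)) c ⟨
    ∑ m c * rowDot (transpose H) (suc k) (suc k′)
      ∎
    where
    open ≡-Reasoning
    c : Fin m → ℤ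
    c = coefficient k a k′ a′
    regroup : ∀ s s′ h h′ g g′ → (s * (h * g)) * (s′ * (h′ * g′)) ≡ s * s′ * (h * h′) * (g * g′)
    regroup = solve-∀

  blockMatrix-isPM1 : (∀ k l → IsSign (σ k l)) → IsPM1 H → IsPM1 blockMatrix
  blockMatrix-isPM1 σ-sign H-sign x y = sign-* (σ-sign _ _) (sign-* (H-sign _ _) (H-sign _ _))

  blockMatrix-symmetric : (∀ k l → σ k l ≡ σ l k) → Symmetric blockMatrix
  blockMatrix-symmetric σ-sym x y = entry-symmetric (remQuot (suc m) x) (remQuot (suc m) y)
    where
    entry-symmetric : ∀ p q → entry p q ≡ entry q p
    entry-symmetric (k , a) (l , b) = cong₂ _*_ (σ-sym k l) (ℤP.*-comm (H a (suc l)) (H b (suc k)))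

  blockMatrix-blockSkew : (∀ k l → ¬ k ≡ l → σ k l ≡ - σ l k) → BlockSkew (suc m) blockMatrix
  blockMatrix-blockSkew σ-anti k l a b k≢l = begin
    blockMatrix (combine k b) (combine l a)    ≡⟨ blockMatrix-combine k b l a ⟩
    σ k l * (H b (suc l) * H a (suc k))        ≡⟨ cong (_* _) (σ-anti k l k≢l) ⟩
    - σ l k * (H b (suc l) * H a (suc k))      ≡⟨ swap-neg (σ l k) (H b (suc l)) (H a (suc k)) ⟩
    - (σ l k * (H a (suc k) * H b (suc l)))    ≡⟨ cong -_ (blockMatrix-combine l a k b) ⟨
    - blockMatrix (combine l a) (combine k b)  ∎
    where
    open ≡-Reasoning
    swap-neg : ∀ s g h → - s * (g * h) ≡ - (s * (h * g))
    swap-neg = solve-∀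

  module _ (hadamard : IsHadamard (suc m) H) where

    private
      n : ℤ
      n = + suc m

      column-orthogonal : ∀ j j′ → rowDot (transpose H) j j′ ≡ n * δ j j′
      column-orthogonal = transpose-orthogonal H n (proj₂ hadamard)

    blockMatrix-between : ∀ k k′ a a′ → ¬ k ≡ k′ →
      rowDot blockMatrix (combine k a) (combine k′ a′) ≡ 0ℤ
    blockMatrix-between k k′ a a′ k≢k′ = begin
      rowDot blockMatrix (combine k a) (combine k′ a′)  ≡⟨ rowDot-blockMatrix k a k′ a′ ⟩
      c * rowDot (transpose H) (suc k) (suc k′)         ≡⟨ cong (c *_) (column-orthogonal (suc k) (suc k′)) ⟩
      c * (n * δ k k′)                                  ≡⟨ cong (λ d → c * (n * d)) (δ-≢ k≢k′) ⟩
      c * (n * 0ℤ)                                      ≡⟨ cong (c *_) (ℤP.*-zeroʳ n) ⟩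
      c * 0ℤ                                            ≡⟨ ℤP.*-zeroʳ c ⟩
      0ℤ                                                ∎
      where
      open ≡-Reasoning
      c : ℤ
      c = ∑ m (coefficient k a k′ a′)

    rowDot-tail≡-head*head : ∀ a a′ → ¬ a ≡ a′ →
      ∑ m (λ l → H a (suc l) * H a′ (suc l)) ≡ - (H a zero * H a′ zero)
    rowDot-tail≡-head*head a a′ a≢a′ = +-inverseʳ-unique (H a zero * H a′ zero) _
      (trans (proj₂ hadamard a a′) (trans (cong (n *_) (δ-≢ a≢a′)) (ℤP.*-zeroʳ n)))

    rowDot-blockMatrix-within : (∀ k l → IsSign (σ k l)) → ∀ k a a′ → ¬ a ≡ a′ →
      rowDot blockMatrix (combine k a) (combine k a′) ≡ - (H a zero * H a′ zero) * n
    rowDot-blockMatrix-within σ-sign k a a′ a≢a′ = begin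
      rowDot blockMatrix (combine k a) (combine k a′)
        ≡⟨ rowDot-blockMatrix k a k a′ ⟩
      ∑ m (coefficient k a k a′) * rowDot (transpose H) (suc k) (suc k)
        ≡⟨ cong₂ _*_ (∑-cong m (λ l → trans (cong (_* _) (sign*sign≡1 (σ-sign k l))) (ℤP.*-identityˡ _)))
                     (column-orthogonal (suc k) (suc k)) ⟩
      ∑ m (λ l → H a (suc l) * H a′ (suc l)) * (n * δ k k)
        ≡⟨ cong₂ _*_ (rowDot-tail≡-head*head a a′ a≢a′)
                     (trans (cong (n *_) (δ-refl k)) (ℤP.*-identityʳ n)) ⟩
      - (H a zero * H a′ zero) * n
        ∎
      where open ≡-Reasoning

    blockMatrix-within : (∀ k l → IsSign (σ k l)) → ∀ k a a′ → ¬ a ≡ a′ →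
      ∣ rowDot blockMatrix (combine k a) (combine k a′) ∣ ≡ suc m
    blockMatrix-within σ-sign k a a′ a≢a′ = begin
      ∣ rowDot blockMatrix (combine k a) (combine k a′) ∣  ≡⟨ cong ∣_∣ (rowDot-blockMatrix-within σ-sign k a a′ a≢a′) ⟩
      ∣ - u * n ∣                                         ≡⟨ ℤP.abs-* (- u) n ⟩
      ∣ - u ∣ ℕ.* suc m                                   ≡⟨ cong (ℕ._* suc m) (trans (ℤP.∣-i∣≡∣i∣ u) (∣sign∣≡1 u±1)) ⟩
      1 ℕ.* suc m                                         ≡⟨ ℕP.*-identityˡ (suc m) ⟩
      suc m                                               ∎
      where
      open ≡-Reasoning
      u : ℤ
      u = H a zero * H a′ zero
      u±1 : IsSign u
      u±1 = sign-* (proj₁ hadamard a zero) (proj₁ hadamard a′ zero)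

    blockMatrix-biangular : (∀ k l → IsSign (σ k l)) →
      BiangularClasses (suc m) (m ℕ.* suc m) blockMatrix (blockIndex (suc m))
    blockMatrix-biangular σ-sign = blockMatrix-within σ-sign , blockMatrix-between

orientation : ∀ {m} → Fin m → Fin m → ℤ
orientation k l with k FinP.≤? l
... | yes _ = 1ℤ
... | no  _ = -1ℤ

orientation-isSign : ∀ {m} (k l : Fin m) → IsSign (orientation k l)
orientation-isSign k l with k FinP.≤? l
... | yes _ = inj₁ refl
... | no  _ = inj₂ refl

orientation-antisymmetric : ∀ {m} (k l : Fin m) → ¬ k ≡ l → orientation k l ≡ - orientation l k
orientation-antisymmetric k l k≢l with k FinP.≤? l | l FinP.≤? k
... | yes k≤l | yes l≤k = contradiction (FinP.≤-antisym k≤l l≤k) k≢l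
... | yes _   | no  _   = refl
... | no  _   | yes _   = refl
... | no  k≰l | no  l≰k =
  contradiction (FinP.≤-total k l) λ { (inj₁ k≤l) → k≰l k≤l ; (inj₂ l≤k) → l≰k l≤k }

combine⤖ : ∀ {m n} → (Fin m × Fin n) ⤖ Fin (m ℕ.* n)
combine⤖ = ↔⇒⤖ (↔-sym FinP.*↔×)

SymmetricBiangular : ℕ → ℕ → Set
SymmetricBiangular n N = ∃ λ (M : Matrix N) → Σ ((Fin (n ℕ.∸ 1) × Fin n) ⤖ Fin N) λ cls →
  IsPM1 M × Symmetric M × BiangularClasses n N M (Bijection.to cls)

theorem5p2 : (n : ℕ) → .{{_ : NonZero n}} → (∃ λ (H : Matrix n) → IsHadamard n H) →
    (∃ λ (M : Matrix (n ℕ.* (n ℕ.∸ 1))) →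
      Σ ((Fin (n ℕ.∸ 1) × Fin n) ⤖ Fin (n ℕ.* (n ℕ.∸ 1))) λ cls →
        IsPM1 M × Symmetric M × BiangularClasses n (n ℕ.* (n ℕ.∸ 1)) M (Bijection.to cls))
    × (∃ λ (M : Matrix ((n ℕ.∸ 1) ℕ.* n)) →
        IsPM1 M × BiangularClasses n ((n ℕ.∸ 1) ℕ.* n) M (blockIndex n) × BlockSkew n M)
theorem5p2 (suc m) (H , hadamard@(H-isPM1 , _)) =
  subst (SymmetricBiangular (suc m)) (ℕP.*-comm m (suc m))
    ( S.blockMatrix , combine⤖
    , S.blockMatrix-isPM1 (λ _ _ → inj₁ refl) H-isPM1
    , S.blockMatrix-symmetric (λ _ _ → refl)
    , S.blockMatrix-biangular hadamard (λ _ _ → inj₁ refl) )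
  , ( A.blockMatrix
    , A.blockMatrix-isPM1 orientation-isSign H-isPM1
    , A.blockMatrix-biangular hadamard orientation-isSign
    , A.blockMatrix-blockSkew orientation-antisymmetric )
  where
  module S = BlockConstruction (λ _ _ → 1ℤ) H
  module A = BlockConstruction orientation H
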